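{- For every integer $n \ge 2$, $\mathrm{indsat}(n, \{2K_2, C_4, C_5\}) \neq 0$.
   Context: All graphs are finite and simple; $2K_2$ is the disjoint union of two edges and $C_m$ the cycle on $m$ vertices. A trigraph $T$ consists of a finite vertex set $V(T)$ together with a partition of the set of unordered pairs of distinct vertices of $V(T)$ into black edges, white edges and gray edges. A realization of $T$ is a graph with vertex set $V(T)$ whose edge set consists of all black edges together with some subset of the gray edges. For a family $\mathcal F$ of graphs, a trigraph $T$ is $\mathcal F$-induced-saturated if no realization of $T$ contains any member of $\mathcal F$ as an induced subgraph, but for every black or white edge $e$ of $T$, the trigraph obtained from $T$ by changing $e$ to gray has a realization containing some member of $\mathcal F$ as an induced subgraph. $\mathrm{indsat}(n,\mathcal F)$ is the minimum number of gray edges in an $\mathcal F$-induced-saturated trigraph on $n$ vertices. -}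

module Defs where

open import Data.Nat using (ℕ)
open import Data.Fin using (Fin; zero; suc; _≟_)
open import Data.Bool using (Bool; true; false)
open import Data.Product using (Σ; _×_; ∃; ∃-syntax)
open import Data.Sum using (_⊎_)
open import Data.List using (List; []; _∷_)
open import Data.List.Relation.Unary.Any using (Any)
open import Relation.Binary.PropositionalEquality using (_≡_; _≢_; refl; trans; cong₂)
open import Relation.Nullary.Decidable using (⌊_⌋)
open import Data.Bool using (_∧_; _∨_; if_then_else_)
open import Data.Bool.Properties using (∨-comm; ∧-comm)
open import Relation.Nullary using (¬_; yes; no)
open import Function.Definitions using (Injective)

record Graph (n : ℕ) : Set where
  field
    adj  : Fin n → Fin n → Bool
    sym  : ∀ u v → adj u v ≡ adj v u
    irr  : ∀ u → adj u u ≡ false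
open Graph public

record SomeGraph : Set where
  constructor graph
  field
    order : ℕ
    grph  : Graph order
open SomeGraph public

_IsInducedIn_ : ∀ {k n} → Graph k → Graph n → Set
_IsInducedIn_ {k} {n} H G =
  Σ (Fin k → Fin n) λ f → Injective _≡_ _≡_ f × (∀ i j → adj G (f i) (f j) ≡ adj H i j)

ContainsInduced : ∀ {n} → List SomeGraph → Graph n → Set
ContainsInduced F G = Any (λ H → grph H IsInducedIn G) F

-- Trigraphs: each unordered pair of distinct vertices is black, white or gray.
data Colour : Set where
  black white gray : Colour

record Trigraph (n : ℕ) : Set where
  field
    col    : Fin n → Fin n → Colour
    colSym : ∀ u v → col u v ≡ col v u
open Trigraph public
-- (the value col u u on the diagonal is irrelevant and never used)

IsRealization : ∀ {n} → Trigraph n → Graph n → Set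
IsRealization T G = ∀ u v → u ≢ v →
  (col T u v ≡ black → adj G u v ≡ true) × (col T u v ≡ white → adj G u v ≡ false)

isPair : ∀ {n} → Fin n → Fin n → Fin n → Fin n → Bool
isPair a b u v = (⌊ u ≟ a ⌋ ∧ ⌊ v ≟ b ⌋) ∨ (⌊ u ≟ b ⌋ ∧ ⌊ v ≟ a ⌋)

isPairSym : ∀ {n} (a b u v : Fin n) → isPair a b u v ≡ isPair a b v u
isPairSym a b u v with ⌊ u ≟ a ⌋ | ⌊ v ≟ b ⌋ | ⌊ u ≟ b ⌋ | ⌊ v ≟ a ⌋
... | x | y | z | w = trans (∨-comm (x ∧ y) (z ∧ w))
                        (cong₂ _∨_ (∧-comm z w) (∧-comm x y))

makeGray : ∀ {n} → Trigraph n → Fin n → Fin n → Trigraph n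
makeGray T a b = record
  { col    = λ u v → if isPair a b u v then gray else col T u v
  ; colSym = λ u v → cong₂ (λ c d → if c then gray else d) (isPairSym a b u v) (colSym T u v)
  }

NoGray : ∀ {n} → Trigraph n → Set
NoGray T = ∀ u v → u ≢ v → col T u v ≢ gray

IndSaturated : ∀ {n} → List SomeGraph → Trigraph n → Set
IndSaturated {n} F T =
  (∀ (G : Graph n) → IsRealization T G → ¬ ContainsInduced F G)
  × (∀ u v → u ≢ v → col T u v ≢ gray →
       ∃[ G ] (IsRealization (makeGray T u v) G × ContainsInduced F G))

-- 2K2 on {0,1,2,3}: edges 01, 23.
adj2K2 : Fin 4 → Fin 4 → Bool
adj2K2 zero zero = false
adj2K2 zero (suc zero) = true
adj2K2 zero (suc (suc zero)) = false
adj2K2 zero (suc (suc (suc zero))) = false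
adj2K2 (suc zero) zero = true
adj2K2 (suc zero) (suc zero) = false
adj2K2 (suc zero) (suc (suc zero)) = false
adj2K2 (suc zero) (suc (suc (suc zero))) = false
adj2K2 (suc (suc zero)) zero = false
adj2K2 (suc (suc zero)) (suc zero) = false
adj2K2 (suc (suc zero)) (suc (suc zero)) = false
adj2K2 (suc (suc zero)) (suc (suc (suc zero))) = true
adj2K2 (suc (suc (suc zero))) zero = false
adj2K2 (suc (suc (suc zero))) (suc zero) = false
adj2K2 (suc (suc (suc zero))) (suc (suc zero)) = true
adj2K2 (suc (suc (suc zero))) (suc (suc (suc zero))) = false

sym2K2 : ∀ i j → adj2K2 i j ≡ adj2K2 j i
sym2K2 zero zero = refl
sym2K2 zero (suc zero) = refl
sym2K2 zero (suc (suc zero)) = refl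
sym2K2 zero (suc (suc (suc zero))) = refl
sym2K2 (suc zero) zero = refl
sym2K2 (suc zero) (suc zero) = refl
sym2K2 (suc zero) (suc (suc zero)) = refl
sym2K2 (suc zero) (suc (suc (suc zero))) = refl
sym2K2 (suc (suc zero)) zero = refl
sym2K2 (suc (suc zero)) (suc zero) = refl
sym2K2 (suc (suc zero)) (suc (suc zero)) = refl
sym2K2 (suc (suc zero)) (suc (suc (suc zero))) = refl
sym2K2 (suc (suc (suc zero))) zero = refl
sym2K2 (suc (suc (suc zero))) (suc zero) = refl
sym2K2 (suc (suc (suc zero))) (suc (suc zero)) = refl
sym2K2 (suc (suc (suc zero))) (suc (suc (suc zero))) = refl

irr2K2 : ∀ i → adj2K2 i i ≡ false
irr2K2 zero = refl
irr2K2 (suc zero) = refl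
irr2K2 (suc (suc zero)) = refl
irr2K2 (suc (suc (suc zero))) = refl

2K2 : SomeGraph
2K2 = graph 4 record { adj = adj2K2 ; sym = sym2K2 ; irr = irr2K2 }

-- C4: cycle 0-1-2-3-0.
adjC4 : Fin 4 → Fin 4 → Bool
adjC4 zero zero = false
adjC4 zero (suc zero) = true
adjC4 zero (suc (suc zero)) = false
adjC4 zero (suc (suc (suc zero))) = true
adjC4 (suc zero) zero = true
adjC4 (suc zero) (suc zero) = false
adjC4 (suc zero) (suc (suc zero)) = true
adjC4 (suc zero) (suc (suc (suc zero))) = false
adjC4 (suc (suc zero)) zero = false
adjC4 (suc (suc zero)) (suc zero) = true
adjC4 (suc (suc zero)) (suc (suc zero)) = false
adjC4 (suc (suc zero)) (suc (suc (suc zero))) = true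
adjC4 (suc (suc (suc zero))) zero = true
adjC4 (suc (suc (suc zero))) (suc zero) = false
adjC4 (suc (suc (suc zero))) (suc (suc zero)) = true
adjC4 (suc (suc (suc zero))) (suc (suc (suc zero))) = false

symC4 : ∀ i j → adjC4 i j ≡ adjC4 j i
symC4 zero zero = refl
symC4 zero (suc zero) = refl
symC4 zero (suc (suc zero)) = refl
symC4 zero (suc (suc (suc zero))) = refl
symC4 (suc zero) zero = refl
symC4 (suc zero) (suc zero) = refl
symC4 (suc zero) (suc (suc zero)) = refl
symC4 (suc zero) (suc (suc (suc zero))) = refl
symC4 (suc (suc zero)) zero = refl
symC4 (suc (suc zero)) (suc zero) = refl
symC4 (suc (suc zero)) (suc (suc zero)) = refl
symC4 (suc (suc zero)) (suc (suc (suc zero))) = refl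
symC4 (suc (suc (suc zero))) zero = refl
symC4 (suc (suc (suc zero))) (suc zero) = refl
symC4 (suc (suc (suc zero))) (suc (suc zero)) = refl
symC4 (suc (suc (suc zero))) (suc (suc (suc zero))) = refl

irrC4 : ∀ i → adjC4 i i ≡ false
irrC4 zero = refl
irrC4 (suc zero) = refl
irrC4 (suc (suc zero)) = refl
irrC4 (suc (suc (suc zero))) = refl

C4 : SomeGraph
C4 = graph 4 record { adj = adjC4 ; sym = symC4 ; irr = irrC4 }

-- C5: cycle 0-1-2-3-4-0.
adjC5 : Fin 5 → Fin 5 → Bool
adjC5 zero zero = false
adjC5 zero (suc zero) = true
adjC5 zero (suc (suc zero)) = false
adjC5 zero (suc (suc (suc zero))) = false
adjC5 zero (suc (suc (suc (suc zero)))) = true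
adjC5 (suc zero) zero = true
adjC5 (suc zero) (suc zero) = false
adjC5 (suc zero) (suc (suc zero)) = true
adjC5 (suc zero) (suc (suc (suc zero))) = false
adjC5 (suc zero) (suc (suc (suc (suc zero)))) = false
adjC5 (suc (suc zero)) zero = false
adjC5 (suc (suc zero)) (suc zero) = true
adjC5 (suc (suc zero)) (suc (suc zero)) = false
adjC5 (suc (suc zero)) (suc (suc (suc zero))) = true
adjC5 (suc (suc zero)) (suc (suc (suc (suc zero)))) = false
adjC5 (suc (suc (suc zero))) zero = false
adjC5 (suc (suc (suc zero))) (suc zero) = false
adjC5 (suc (suc (suc zero))) (suc (suc zero)) = true
adjC5 (suc (suc (suc zero))) (suc (suc (suc zero))) = false
adjC5 (suc (suc (suc zero))) (suc (suc (suc (suc zero)))) = true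
adjC5 (suc (suc (suc (suc zero)))) zero = true
adjC5 (suc (suc (suc (suc zero)))) (suc zero) = false
adjC5 (suc (suc (suc (suc zero)))) (suc (suc zero)) = false
adjC5 (suc (suc (suc (suc zero)))) (suc (suc (suc zero))) = true
adjC5 (suc (suc (suc (suc zero)))) (suc (suc (suc (suc zero)))) = false

symC5 : ∀ i j → adjC5 i j ≡ adjC5 j i
symC5 zero zero = refl
symC5 zero (suc zero) = refl
symC5 zero (suc (suc zero)) = refl
symC5 zero (suc (suc (suc zero))) = refl
symC5 zero (suc (suc (suc (suc zero)))) = refl
symC5 (suc zero) zero = refl
symC5 (suc zero) (suc zero) = refl
symC5 (suc zero) (suc (suc zero)) = refl
symC5 (suc zero) (suc (suc (suc zero))) = refl
symC5 (suc zero) (suc (suc (suc (suc zero)))) = refl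
symC5 (suc (suc zero)) zero = refl
symC5 (suc (suc zero)) (suc zero) = refl
symC5 (suc (suc zero)) (suc (suc zero)) = refl
symC5 (suc (suc zero)) (suc (suc (suc zero))) = refl
symC5 (suc (suc zero)) (suc (suc (suc (suc zero)))) = refl
symC5 (suc (suc (suc zero))) zero = refl
symC5 (suc (suc (suc zero))) (suc zero) = refl
symC5 (suc (suc (suc zero))) (suc (suc zero)) = refl
symC5 (suc (suc (suc zero))) (suc (suc (suc zero))) = refl
symC5 (suc (suc (suc zero))) (suc (suc (suc (suc zero)))) = refl
symC5 (suc (suc (suc (suc zero)))) zero = refl
symC5 (suc (suc (suc (suc zero)))) (suc zero) = refl
symC5 (suc (suc (suc (suc zero)))) (suc (suc zero)) = refl
symC5 (suc (suc (suc (suc zero)))) (suc (suc (suc zero))) = refl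
symC5 (suc (suc (suc (suc zero)))) (suc (suc (suc (suc zero)))) = refl

irrC5 : ∀ i → adjC5 i i ≡ false
irrC5 zero = refl
irrC5 (suc zero) = refl
irrC5 (suc (suc zero)) = refl
irrC5 (suc (suc (suc zero))) = refl
irrC5 (suc (suc (suc (suc zero)))) = refl

C5 : SomeGraph
C5 = graph 5 record { adj = adjC5 ; sym = symC5 ; irr = irrC5 }

F-2K2-C4-C5 : List SomeGraph
F-2K2-C4-C5 = 2K2 ∷ C4 ∷ C5 ∷ []

-- A trigraph without gray edges is a single graph G, and saturation would mean that
-- flipping any one pair of G creates an induced 2K₂, C₄ or C₅.  But a {2K₂, C₄, C₅}-free
-- graph always has a pair that can be flipped safely.  If u has maximum degree, the
-- non-neighbours of u form an independent set: for an edge xy among them, a neighbour of u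
-- missing x (it exists since deg x ≤ deg u) yields a 2K₂, C₄ or C₅.  Hence adding edges at u
-- creates no obstruction, since any new one would contain an edge between two old
-- non-neighbours of u.  So if u is not universal we add an edge at u; otherwise, in the
-- complement a vertex of maximum degree is not universal, and as the family is closed under
-- complementation the same argument deletes an edge of G.
module Submission where

open import Defs
open import Data.Nat using (ℕ; _≤_; zero; suc; s≤s)
open import Relation.Nullary using (¬_)

open import Data.Bool using (Bool; true; false; not; _∧_; T; if_then_else_)
import Data.Bool as Bool
open import Data.Bool.Properties using (T-≡; T-∧; T-∨; not-involutive)
open import Data.Empty using (⊥; ⊥-elim)
open import Data.Fin using (Fin; zero; suc; _≟_; #_; punchIn)
open import Data.Fin.Properties using (any?; punchInᵢ≢i)
open import Data.Fin.Subset using (Subset; _∈_; _∉_; _⊆_; ∣_∣)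
open import Data.Fin.Subset.Properties using (p⊂q⇒∣p∣<∣q∣)
open import Data.List using (allFin)
open import Data.List.Extrema.Nat using (argmax; f[xs]≤f[argmax])
open import Data.List.Membership.Propositional.Properties using (∈-allFin)
import Data.List.Relation.Unary.All as All
open import Data.List.Relation.Unary.Any using (here; there)
open import Data.Nat.Properties using (<⇒≱)
open import Data.Product using (∃; ∃₂; _×_; _,_; proj₁; proj₂)
open import Data.Sum using (_⊎_; inj₁; inj₂)
import Data.Sum as Sum
open import Data.Vec using (Vec; []; _∷_; lookup; tabulate)
open import Data.Vec.Properties using (lookup∘tabulate; []=⇒lookup; lookup⇒[]=)
open import Data.Vec.Relation.Unary.All using ([]; _∷_)
open import Data.Vec.Relation.Unary.AllPairs using ([]; _∷_)
open import Data.Vec.Relation.Unary.Unique.Propositional using (Unique)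
open import Data.Vec.Relation.Unary.Unique.Propositional.Properties using (lookup-injective)
open import Function using (_∘_; case_of_)
open import Function.Bundles using (Equivalence)
open import Function.Definitions using (Injective)
open import Relation.Nullary using (yes; no; contradiction)
open import Relation.Nullary.Decidable
  using (⌊_⌋; does; toWitness; _×-dec_; ¬?; map′; dec-true; dec-false; does-≡)
open import Relation.Binary.PropositionalEquality as ≡
  using (_≡_; _≢_; refl; trans; cong; cong₂; ≢-sym)

private
  variable
    n : ℕ
    β : Bool
    G H : Graph n
    a b c d e u v x y z : Fin n

conflict : β ≡ true → β ≡ false → ⊥
conflict refl ()

module Adjacency (G : Graph n) where

  swap : adj G x y ≡ β → adj G y x ≡ β
  swap {x = x} {y = y} xy = trans (Graph.sym G y x) xy

  edge⇒≢ : adj G x y ≡ true → x ≢ y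
  edge⇒≢ xy refl = conflict xy (irr G _)

  separated : adj G x z ≡ true → adj G y z ≡ false → x ≢ y
  separated xz yz refl = conflict xz yz

data Obstruction (G : Graph n) : Set where
  2K₂ : adj G a b ≡ true → adj G c d ≡ true →
        adj G a c ≡ false → adj G a d ≡ false → adj G b c ≡ false → adj G b d ≡ false →
        Obstruction G
  C₄  : a ≢ c → b ≢ d →
        adj G a b ≡ true → adj G b c ≡ true → adj G c d ≡ true → adj G d a ≡ true →
        adj G a c ≡ false → adj G b d ≡ false →
        Obstruction G
  C₅  : adj G a b ≡ true → adj G b c ≡ true → adj G c d ≡ true → adj G d e ≡ true →
        adj G e a ≡ true →
        adj G a c ≡ false → adj G a d ≡ false → adj G b d ≡ false → adj G b e ≡ false →
        adj G c e ≡ false →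
        Obstruction G

Free : Graph n → Set
Free G = ¬ Obstruction G

induced⇒obstruction : ContainsInduced F-2K2-C4-C5 G → Obstruction G
induced⇒obstruction (here (f , _ , f-adj)) =
  2K₂ (f-adj (# 0) (# 1)) (f-adj (# 2) (# 3))
      (f-adj (# 0) (# 2)) (f-adj (# 0) (# 3)) (f-adj (# 1) (# 2)) (f-adj (# 1) (# 3))
induced⇒obstruction (there (here (f , f-inj , f-adj))) =
  C₄ (λ f0≡f2 → case f-inj f0≡f2 of λ ()) (λ f1≡f3 → case f-inj f1≡f3 of λ ())
     (f-adj (# 0) (# 1)) (f-adj (# 1) (# 2)) (f-adj (# 2) (# 3)) (f-adj (# 3) (# 0))
     (f-adj (# 0) (# 2)) (f-adj (# 1) (# 3))
induced⇒obstruction (there (there (here (f , _ , f-adj)))) =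
  C₅ (f-adj (# 0) (# 1)) (f-adj (# 1) (# 2)) (f-adj (# 2) (# 3)) (f-adj (# 3) (# 4))
     (f-adj (# 4) (# 0))
     (f-adj (# 0) (# 2)) (f-adj (# 0) (# 3)) (f-adj (# 1) (# 3)) (f-adj (# 1) (# 4))
     (f-adj (# 2) (# 4))

lookup-Injective : ∀ {m} {xs : Vec (Fin n) m} → Unique xs → Injective _≡_ _≡_ (lookup xs)
lookup-Injective unique {i} {j} = lookup-injective unique i j

obstruction⇒induced : Obstruction G → ContainsInduced F-2K2-C4-C5 G
obstruction⇒induced {G = G} (2K₂ {a = a} {b = b} {c = c} {d = d} ab cd ac ad bc bd) =
  here (lookup vs , lookup-Injective distinct , preserves)
  where
  open Adjacency G
  vs : Vec (Fin _) 4
  vs = a ∷ b ∷ c ∷ d ∷ []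
  distinct : Unique vs
  distinct = (edge⇒≢ ab ∷ separated ab (swap bc) ∷ separated ab (swap bd) ∷ [])
           ∷ (separated (swap ab) (swap ac) ∷ separated (swap ab) (swap ad) ∷ [])
           ∷ (edge⇒≢ cd ∷ []) ∷ [] ∷ []
  preserves : ∀ i j → adj G (lookup vs i) (lookup vs j) ≡ adj2K2 i j
  preserves zero zero = irr G a
  preserves zero (suc zero) = ab
  preserves zero (suc (suc zero)) = ac
  preserves zero (suc (suc (suc zero))) = ad
  preserves (suc zero) zero = swap ab
  preserves (suc zero) (suc zero) = irr G b
  preserves (suc zero) (suc (suc zero)) = bc
  preserves (suc zero) (suc (suc (suc zero))) = bd
  preserves (suc (suc zero)) zero = swap ac
  preserves (suc (suc zero)) (suc zero) = swap bc
  preserves (suc (suc zero)) (suc (suc zero)) = irr G c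
  preserves (suc (suc zero)) (suc (suc (suc zero))) = cd
  preserves (suc (suc (suc zero))) zero = swap ad
  preserves (suc (suc (suc zero))) (suc zero) = swap bd
  preserves (suc (suc (suc zero))) (suc (suc zero)) = swap cd
  preserves (suc (suc (suc zero))) (suc (suc (suc zero))) = irr G d
obstruction⇒induced {G = G} (C₄ {a = a} {c = c} {b = b} {d = d} a≢c b≢d ab bc cd da ac bd) =
  there (here (lookup vs , lookup-Injective distinct , preserves))
  where
  open Adjacency G
  vs : Vec (Fin _) 4
  vs = a ∷ b ∷ c ∷ d ∷ []
  distinct : Unique vs
  distinct = (edge⇒≢ ab ∷ a≢c ∷ ≢-sym (edge⇒≢ da) ∷ [])
           ∷ (edge⇒≢ bc ∷ b≢d ∷ []) ∷ (edge⇒≢ cd ∷ []) ∷ [] ∷ []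
  preserves : ∀ i j → adj G (lookup vs i) (lookup vs j) ≡ adjC4 i j
  preserves zero zero = irr G a
  preserves zero (suc zero) = ab
  preserves zero (suc (suc zero)) = ac
  preserves zero (suc (suc (suc zero))) = swap da
  preserves (suc zero) zero = swap ab
  preserves (suc zero) (suc zero) = irr G b
  preserves (suc zero) (suc (suc zero)) = bc
  preserves (suc zero) (suc (suc (suc zero))) = bd
  preserves (suc (suc zero)) zero = swap ac
  preserves (suc (suc zero)) (suc zero) = swap bc
  preserves (suc (suc zero)) (suc (suc zero)) = irr G c
  preserves (suc (suc zero)) (suc (suc (suc zero))) = cd
  preserves (suc (suc (suc zero))) zero = da
  preserves (suc (suc (suc zero))) (suc zero) = swap bd
  preserves (suc (suc (suc zero))) (suc (suc zero)) = swap cd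
  preserves (suc (suc (suc zero))) (suc (suc (suc zero))) = irr G d
obstruction⇒induced {G = G}
  (C₅ {a = a} {b = b} {c = c} {d = d} {e = e} ab bc cd de ea ac ad bd be ce) =
  there (there (here (lookup vs , lookup-Injective distinct , preserves)))
  where
  open Adjacency G
  vs : Vec (Fin _) 5
  vs = a ∷ b ∷ c ∷ d ∷ e ∷ []
  distinct : Unique vs
  distinct = (edge⇒≢ ab ∷ separated (swap ea) ce ∷ separated ab (swap bd)
               ∷ ≢-sym (edge⇒≢ ea) ∷ [])
           ∷ (edge⇒≢ bc ∷ separated (swap ab) (swap ad) ∷ separated bc (swap ce) ∷ [])
           ∷ (edge⇒≢ cd ∷ separated (swap bc) (swap be) ∷ [])
           ∷ (edge⇒≢ de ∷ []) ∷ [] ∷ []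
  preserves : ∀ i j → adj G (lookup vs i) (lookup vs j) ≡ adjC5 i j
  preserves zero zero = irr G a
  preserves zero (suc zero) = ab
  preserves zero (suc (suc zero)) = ac
  preserves zero (suc (suc (suc zero))) = ad
  preserves zero (suc (suc (suc (suc zero)))) = swap ea
  preserves (suc zero) zero = swap ab
  preserves (suc zero) (suc zero) = irr G b
  preserves (suc zero) (suc (suc zero)) = bc
  preserves (suc zero) (suc (suc (suc zero))) = bd
  preserves (suc zero) (suc (suc (suc (suc zero)))) = be
  preserves (suc (suc zero)) zero = swap ac
  preserves (suc (suc zero)) (suc zero) = swap bc
  preserves (suc (suc zero)) (suc (suc zero)) = irr G c
  preserves (suc (suc zero)) (suc (suc (suc zero))) = cd
  preserves (suc (suc zero)) (suc (suc (suc (suc zero)))) = ce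
  preserves (suc (suc (suc zero))) zero = swap ad
  preserves (suc (suc (suc zero))) (suc zero) = swap bd
  preserves (suc (suc (suc zero))) (suc (suc zero)) = swap cd
  preserves (suc (suc (suc zero))) (suc (suc (suc zero))) = irr G d
  preserves (suc (suc (suc zero))) (suc (suc (suc (suc zero)))) = de
  preserves (suc (suc (suc (suc zero)))) zero = ea
  preserves (suc (suc (suc (suc zero)))) (suc zero) = swap be
  preserves (suc (suc (suc (suc zero)))) (suc (suc zero)) = swap ce
  preserves (suc (suc (suc (suc zero)))) (suc (suc (suc zero))) = swap de
  preserves (suc (suc (suc (suc zero)))) (suc (suc (suc (suc zero)))) = irr G e

loopless : (r : Fin n → Fin n → Bool) → (∀ x y → r x y ≡ r y x) → Graph n
loopless r r-sym = record
  { adj = λ x y → not (does (x ≟ y)) ∧ r x y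
  ; sym = λ x y → cong₂ (λ p q → not p ∧ q) (does-≡ (x ≟ y) (map′ ≡.sym ≡.sym (y ≟ x))) (r-sym x y)
  ; irr = λ x → cong (λ p → not p ∧ r x x) (dec-true (x ≟ x) refl)
  }

loopless-adj : (r : Fin n → Fin n → Bool) (r-sym : ∀ x y → r x y ≡ r y x) →
               x ≢ y → adj (loopless r r-sym) x y ≡ r x y
loopless-adj {x = x} {y = y} r _ x≢y = cong (λ p → not p ∧ r x y) (dec-false (x ≟ y) x≢y)

complement : Graph n → Graph n
complement G = loopless (λ x y → not (adj G x y)) (λ x y → cong not (Graph.sym G x y))

Complementary : Graph n → Graph n → Set
Complementary G H = ∀ {x y} → x ≢ y → adj H x y ≡ not (adj G x y)

complement-complementary : (G : Graph n) → Complementary G (complement G)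
complement-complementary G = loopless-adj _ (λ x y → cong not (Graph.sym G x y))

complementary-sym : Complementary G H → Complementary H G
complementary-sym G~H x≢y = trans (≡.sym (not-involutive _)) (cong not (≡.sym (G~H x≢y)))

module _ {G H : Graph n} (G~H : Complementary G H) where

  open Adjacency G

  edge-flipped : adj G x y ≡ true → adj H x y ≡ false
  edge-flipped xy = trans (G~H (edge⇒≢ xy)) (cong not xy)

  nonEdge-flipped : x ≢ y → adj G x y ≡ false → adj H x y ≡ true
  nonEdge-flipped x≢y xy = trans (G~H x≢y) (cong not xy)

  -- The complement of 2K₂ ab|cd is the 4-cycle acbd, and that of the 5-cycle abcde is acebd.
  complementary-obstruction : Obstruction G → Obstruction H
  complementary-obstruction (2K₂ ab cd ac ad bc bd) =
    C₄ (edge⇒≢ ab) (edge⇒≢ cd)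
       (nonEdge-flipped (separated ab (swap bc)) ac)
       (nonEdge-flipped (separated cd bd) (swap bc))
       (nonEdge-flipped (separated (swap ab) (swap ad)) bd)
       (nonEdge-flipped (separated (swap cd) ac) (swap ad))
       (edge-flipped ab) (edge-flipped cd)
  complementary-obstruction (C₄ a≢c b≢d ab bc cd da ac bd) =
    2K₂ (nonEdge-flipped a≢c ac) (nonEdge-flipped b≢d bd)
        (edge-flipped ab) (edge-flipped (swap da)) (edge-flipped (swap bc)) (edge-flipped cd)
  complementary-obstruction (C₅ ab bc cd de ea ac ad bd be ce) =
    C₅ (nonEdge-flipped (separated (swap ea) ce) ac)
       (nonEdge-flipped (separated (swap bc) (swap be)) ce)
       (nonEdge-flipped (separated (swap de) bd) (swap be))
       (nonEdge-flipped (separated (swap ab) (swap ad)) bd)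
       (nonEdge-flipped (separated (swap cd) ac) (swap ad))
       (edge-flipped (swap ea)) (edge-flipped ab) (edge-flipped (swap bc)) (edge-flipped cd)
       (edge-flipped (swap de))

free-complement : Free G → Free (complement G)
free-complement {G = G} free =
  free ∘ complementary-obstruction
           (complementary-sym {G = G} {H = complement G} (complement-complementary G))

neighbourhood : Graph n → Fin n → Subset n
neighbourhood G x = tabulate (adj G x)

degree : Graph n → Fin n → ℕ
degree G x = ∣ neighbourhood G x ∣

IsMaxDegree : Graph n → Fin n → Set
IsMaxDegree G u = ∀ x → degree G x ≤ degree G u

∈-neighbourhood⁺ : (G : Graph n) → adj G x y ≡ true → y ∈ neighbourhood G x
∈-neighbourhood⁺ {x = x} {y = y} G xy = lookup⇒[]= y _ (trans (lookup∘tabulate (adj G x) y) xy)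

∈-neighbourhood⁻ : (G : Graph n) → y ∈ neighbourhood G x → adj G x y ≡ true
∈-neighbourhood⁻ {y = y} {x = x} G y∈N =
  trans (≡.sym (lookup∘tabulate (adj G x) y)) ([]=⇒lookup y∈N)

exchange : (G : Graph n) → degree G x ≤ degree G u → adj G x y ≡ true → adj G u y ≡ false →
           ∃ λ w → adj G u w ≡ true × adj G x w ≡ false
exchange {x = x} {u = u} {y = y} G x≤u xy uy
  with any? (λ w → (adj G u w Bool.≟ true) ×-dec (adj G x w Bool.≟ false))
... | yes found = found
... | no none = contradiction x≤u (<⇒≱ (p⊂q⇒∣p∣<∣q∣ (Nu⊆Nx , y , ∈-neighbourhood⁺ G xy , y∉Nu)))
  where
  Nu⊆Nx : neighbourhood G u ⊆ neighbourhood G x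
  Nu⊆Nx {w} w∈Nu with adj G x w in xw
  ... | true = ∈-neighbourhood⁺ G xw
  ... | false = contradiction (w , ∈-neighbourhood⁻ G w∈Nu , xw) none
  y∉Nu : y ∉ neighbourhood G u
  y∉Nu y∈Nu = conflict (∈-neighbourhood⁻ G y∈Nu) uy

-- Opaque: only the specification is needed, and unfolding argmax inside types is very slow.
opaque
  maximiser : ∀ {k} (f : Fin (suc k) → ℕ) → ∃ λ m → ∀ x → f x ≤ f m
  maximiser f =
    argmax f zero (allFin _) ,
    λ x → All.lookup (f[xs]≤f[argmax] {f = f} zero (allFin _)) (∈-allFin x)

module _ {G : Graph n} {u : Fin n} (free : Free G) (u-max : IsMaxDegree G u) where

  open Adjacency G

  nonNeighbours-independent : adj G x y ≡ true → adj G u x ≡ false → adj G u y ≡ false → ⊥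
  nonNeighbours-independent {x = x} {y = y} xy ux uy with exchange G (u-max x) xy uy
  ... | w , uw , xw with adj G w y in wy
  ... | false = free (2K₂ uw xy ux uy (swap xw) wy)
  ... | true with exchange G (u-max y) (swap xy) ux
  ... | z , uz , yz with adj G z x in zx
  ... | false = free (2K₂ uz (swap xy) uy ux (swap yz) zx)
  ... | true with adj G z w in zw
  ... | true = free (C₄ (separated (swap uz) (swap uy)) (≢-sym (separated (swap uw) (swap ux)))
                        zx xy (swap wy) (swap zw) (swap yz) xw)
  ... | false = free (C₅ uz zx xy (swap wy) (swap uw) ux uy (swap yz) zw xw)

_⊆ₑ_ : Graph n → Graph n → Set
G ⊆ₑ H = ∀ {x y} → adj G x y ≡ true → adj H x y ≡ true

AgreeAwayFrom : Fin n → Graph n → Graph n → Set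
AgreeAwayFrom u G H = ∀ {x y} → x ≢ u → y ≢ u → adj H x y ≡ adj G x y

module _ {G H : Graph n} {u : Fin n} (free : Free G) (u-max : IsMaxDegree G u)
         (G⊆H : G ⊆ₑ H) (away : AgreeAwayFrom u G H) where

  open Adjacency H

  private
    nonEdge-down : adj H x y ≡ false → adj G x y ≡ false
    nonEdge-down {x = x} {y = y} xy with adj G x y in gxy
    ... | true = ⊥-elim (conflict (G⊆H gxy) xy)
    ... | false = refl

    edge-down : x ≢ u → y ≢ u → adj H x y ≡ true → adj G x y ≡ true
    edge-down x≢u y≢u xy = trans (≡.sym (away x≢u y≢u)) xy

    nonNeighboursᴴ-independent : adj H x y ≡ true → adj H u x ≡ false → adj H u y ≡ false → ⊥
    nonNeighboursᴴ-independent xy ux uy =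
      nonNeighbours-independent free u-max
        (edge-down (separated xy uy) (separated (swap xy) ux) xy)
        (nonEdge-down ux) (nonEdge-down uy)

    -- If b or d misses u in G, it is adjacent to c, which misses u too; otherwise the C₄ lies in G.
    C₄-at : b ≢ d → u ≢ c → adj H u b ≡ true → adj H b c ≡ true → adj H c d ≡ true →
            adj H d u ≡ true → adj H u c ≡ false → adj H b d ≡ false → ⊥
    C₄-at {b = b} {d = d} b≢d u≢c ub bc cd du uc bd
      with adj G u b in Gub | adj G u d in Gud
    ... | false | _ =
      nonNeighbours-independent free u-max (edge-down b≢u c≢u bc) Gub (nonEdge-down uc)
      where b≢u = ≢-sym (edge⇒≢ ub); c≢u = ≢-sym u≢c
    ... | _ | false =
      nonNeighbours-independent free u-max (edge-down d≢u c≢u (swap cd)) Gud (nonEdge-down uc)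
      where d≢u = edge⇒≢ du; c≢u = ≢-sym u≢c
    ... | true | true =
      free (C₄ u≢c b≢d Gub (edge-down b≢u c≢u bc) (edge-down c≢u d≢u cd)
               (Adjacency.swap G Gud) (nonEdge-down uc) (nonEdge-down bd))
      where b≢u = ≢-sym (edge⇒≢ ub); c≢u = ≢-sym u≢c; d≢u = edge⇒≢ du

    no2K₂ : adj H a b ≡ true → adj H c d ≡ true →
            adj H a c ≡ false → adj H a d ≡ false → adj H b c ≡ false → adj H b d ≡ false → ⊥
    no2K₂ {a = a} {b = b} {c = c} {d = d} ab cd ac ad bc bd with a ≟ u | b ≟ u | c ≟ u | d ≟ u
    ... | yes refl | _ | _ | _ = nonNeighboursᴴ-independent cd ac ad
    ... | _ | yes refl | _ | _ = nonNeighboursᴴ-independent cd bc bd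
    ... | _ | _ | yes refl | _ = nonNeighboursᴴ-independent ab (swap ac) (swap bc)
    ... | _ | _ | _ | yes refl = nonNeighboursᴴ-independent ab (swap ad) (swap bd)
    ... | no a≢u | no b≢u | no c≢u | no d≢u =
      free (2K₂ (edge-down a≢u b≢u ab) (edge-down c≢u d≢u cd)
                (nonEdge-down ac) (nonEdge-down ad) (nonEdge-down bc) (nonEdge-down bd))

    noC₄ : a ≢ c → b ≢ d → adj H a b ≡ true → adj H b c ≡ true → adj H c d ≡ true →
           adj H d a ≡ true → adj H a c ≡ false → adj H b d ≡ false → ⊥
    noC₄ {a = a} {c = c} {b = b} {d = d} a≢c b≢d ab bc cd da ac bd
      with a ≟ u | b ≟ u | c ≟ u | d ≟ u
    ... | yes refl | _ | _ | _ = C₄-at b≢d a≢c ab bc cd da ac bd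
    ... | _ | yes refl | _ | _ = C₄-at (≢-sym a≢c) b≢d bc cd da ab bd (swap ac)
    ... | _ | _ | yes refl | _ = C₄-at (≢-sym b≢d) (≢-sym a≢c) cd da ab bc (swap ac) (swap bd)
    ... | _ | _ | _ | yes refl = C₄-at a≢c (≢-sym b≢d) da ab bc cd (swap bd) ac
    ... | no a≢u | no b≢u | no c≢u | no d≢u =
      free (C₄ a≢c b≢d (edge-down a≢u b≢u ab) (edge-down b≢u c≢u bc) (edge-down c≢u d≢u cd)
               (edge-down d≢u a≢u da) (nonEdge-down ac) (nonEdge-down bd))

    noC₅ : adj H a b ≡ true → adj H b c ≡ true → adj H c d ≡ true → adj H d e ≡ true →
           adj H e a ≡ true → adj H a c ≡ false → adj H a d ≡ false → adj H b d ≡ false →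
           adj H b e ≡ false → adj H c e ≡ false → ⊥
    noC₅ {a = a} {b = b} {c = c} {d = d} {e = e} ab bc cd de ea ac ad bd be ce
      with a ≟ u | b ≟ u | c ≟ u | d ≟ u | e ≟ u
    ... | yes refl | _ | _ | _ | _ = nonNeighboursᴴ-independent cd ac ad
    ... | _ | yes refl | _ | _ | _ = nonNeighboursᴴ-independent de bd be
    ... | _ | _ | yes refl | _ | _ = nonNeighboursᴴ-independent ea ce (swap ac)
    ... | _ | _ | _ | yes refl | _ = nonNeighboursᴴ-independent ab (swap ad) (swap bd)
    ... | _ | _ | _ | _ | yes refl = nonNeighboursᴴ-independent bc (swap be) (swap ce)
    ... | no a≢u | no b≢u | no c≢u | no d≢u | no e≢u =
      free (C₅ (edge-down a≢u b≢u ab) (edge-down b≢u c≢u bc) (edge-down c≢u d≢u cd)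
               (edge-down d≢u e≢u de) (edge-down e≢u a≢u ea)
               (nonEdge-down ac) (nonEdge-down ad) (nonEdge-down bd) (nonEdge-down be)
               (nonEdge-down ce))

  extendAtMaxDegree-free : Free H
  extendAtMaxDegree-free (2K₂ ab cd ac ad bc bd) = no2K₂ ab cd ac ad bc bd
  extendAtMaxDegree-free (C₄ a≢c b≢d ab bc cd da ac bd) = noC₄ a≢c b≢d ab bc cd da ac bd
  extendAtMaxDegree-free (C₅ ab bc cd de ea ac ad bd be ce) = noC₅ ab bc cd de ea ac ad bd be ce

AgreeOff : Fin n → Fin n → Graph n → Graph n → Set
AgreeOff u v G H = ∀ x y → isPair u v x y ≡ false → adj H x y ≡ adj G x y

isPair⇒≡ : (u v x y : Fin n) → isPair u v x y ≡ true → (x ≡ u × y ≡ v) ⊎ (x ≡ v × y ≡ u)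
isPair⇒≡ _ _ _ _ p = Sum.map witnesses witnesses (Equivalence.to T-∨ (Equivalence.from T-≡ p))
  where
  witnesses : T (⌊ a ≟ b ⌋ ∧ ⌊ c ≟ d ⌋) → a ≡ b × c ≡ d
  witnesses {a = a} {b = b} {c = c} {d = d} t
    with Equivalence.to (T-∧ {⌊ a ≟ b ⌋} {⌊ c ≟ d ⌋}) t
  ... | s , r = toWitness {a? = a ≟ b} s , toWitness {a? = c ≟ d} r

agreeOff-complement : AgreeOff u v G H → AgreeOff u v (complement G) (complement H)
agreeOff-complement agree x y p = cong (λ β → not (does (x ≟ y)) ∧ not β) (agree x y p)

flipNonEdge-free : Free G → IsMaxDegree G u → adj G u v ≡ false → AgreeOff u v G H → Free H
flipNonEdge-free {G = G} {u = u} {v = v} {H = H} free u-max uv agree =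
  extendAtMaxDegree-free free u-max G⊆H away
  where
  G⊆H : G ⊆ₑ H
  G⊆H {x} {y} xy with isPair u v x y in p
  ... | false = trans (agree x y p) xy
  ... | true with isPair⇒≡ u v x y p
  ...   | inj₁ (refl , refl) = ⊥-elim (conflict xy uv)
  ...   | inj₂ (refl , refl) = ⊥-elim (conflict xy (Adjacency.swap G uv))
  away : AgreeAwayFrom u G H
  away {x} {y} x≢u y≢u with isPair u v x y in p
  ... | false = agree x y p
  ... | true with isPair⇒≡ u v x y p
  ...   | inj₁ (x≡u , _) = contradiction x≡u x≢u
  ...   | inj₂ (_ , y≡u) = contradiction y≡u y≢u

flipEdge-free : Free G → IsMaxDegree (complement G) u → adj G u v ≡ true → AgreeOff u v G H → Free H
flipEdge-free {G = G} {H = H} free u-max uv agree =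
  flipNonEdge-free {H = complement H} (free-complement free) u-max
    (edge-flipped {G = G} {H = complement G} (complement-complementary G) uv)
    (agreeOff-complement {G = G} {H = H} agree)
  ∘ complementary-obstruction {G = H} (complement-complementary H)

nonNeighbour⊎neighbour : ∀ {k} (G : Graph (suc (suc k))) (u w : Fin (suc (suc k))) →
                         (∃ λ v → u ≢ v × adj G u v ≡ false) ⊎ (∃ λ v → adj G w v ≡ true)
nonNeighbour⊎neighbour G u w with any? (λ v → ¬? (u ≟ v) ×-dec (adj G u v Bool.≟ false))
... | yes found = inj₁ found
... | no none = inj₂ (neighbour w)
  where
  universal : u ≢ v → adj G u v ≡ true
  universal {v = v} u≢v with adj G u v in uv
  ... | true = refl
  ... | false = contradiction (v , u≢v , uv) none
  neighbour : ∀ w → ∃ λ v → adj G w v ≡ true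
  neighbour w with w ≟ u
  ... | yes refl = punchIn u zero , universal (≢-sym (punchInᵢ≢i u zero))
  ... | no w≢u = u , Adjacency.swap G (universal (≢-sym w≢u))

flippablePair : ∀ {k} (G : Graph (suc (suc k))) → Free G →
                ∃₂ λ u v → u ≢ v × (∀ H → AgreeOff u v G H → Free H)
flippablePair G free with maximiser (degree G) | maximiser (degree (complement G))
... | u , u-max | w , w-max with nonNeighbour⊎neighbour G u w
...   | inj₁ (v , u≢v , uv) = u , v , u≢v , λ _ → flipNonEdge-free free u-max uv
...   | inj₂ (v , wv) = w , v , Adjacency.edge⇒≢ G wv , λ _ → flipEdge-free free w-max wv

isBlack : Colour → Bool
isBlack black = true
isBlack white = false
isBlack gray = false

blackGraph : Trigraph n → Graph n
blackGraph T = loopless (λ x y → isBlack (col T x y)) (λ x y → cong isBlack (colSym T x y))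

blackGraph-realizes : (T : Trigraph n) → IsRealization T (blackGraph T)
blackGraph-realizes T x y x≢y = coloured , coloured
  where
  coloured : ∀ {κ} → col T x y ≡ κ → adj (blackGraph T) x y ≡ isBlack κ
  coloured κ = trans (loopless-adj _ (λ x y → cong isBlack (colSym T x y)) x≢y) (cong isBlack κ)

makeGray-away : (T : Trigraph n) → isPair u v x y ≡ false → col (makeGray T u v) x y ≡ col T x y
makeGray-away {x = x} {y = y} T p = cong (λ β → if β then gray else col T x y) p

realization-agreeOff : (T : Trigraph n) → NoGray T → IsRealization (makeGray T u v) H →
                       AgreeOff u v (blackGraph T) H
realization-agreeOff {H = H} T noGray realizes x y p with x ≟ y
... | yes refl = irr H x
... | no x≢y with col T x y in κ
...   | black = proj₁ (realizes x y x≢y) (trans (makeGray-away T p) κ)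
...   | white = proj₂ (realizes x y x≢y) (trans (makeGray-away T p) κ)
...   | gray = contradiction κ (noGray x y x≢y)

proposition7p3 : (n : ℕ) → 2 ≤ n → (T : Trigraph n) → NoGray T → ¬ IndSaturated F-2K2-C4-C5 T
proposition7p3 (suc zero) (s≤s ())
proposition7p3 (suc (suc k)) _ T noGray (realizationsFree , flipsCreate)
  with flippablePair (blackGraph T)
         (realizationsFree (blackGraph T) (blackGraph-realizes T) ∘ obstruction⇒induced)
... | u , v , u≢v , flipFree with flipsCreate u v u≢v (noGray u v u≢v)
...   | H , realizes , induced =
  flipFree H (realization-agreeOff {u = u} {v = v} {H = H} T noGray realizes)
    (induced⇒obstruction induced)
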